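{- Let $n,k,m$ be integers with $1\le m\le k$ and $k+m\le n$. Let $\mathsf{UComp}_{n,k,m}$ be the set of pairs $(A,c)$ with $A$ a $(k-1)$-element subset of $\{1,\ldots,n\}$ and $c$ a composition of $n$ into exactly $k$ parts of which exactly $m$ are larger than $1$. Let $\mathcal{T}_{n,k,m}$ be the set of plane trees with $n$ edges and $k$ internal nodes, exactly $m$ of which have degree larger than $1$. Then there exists a map $\phi:\mathsf{UComp}_{n,k,m}\to\mathcal{T}_{n,k,m}$ such that every element of $\mathcal{T}_{n,k,m}$ has exactly $k$ preimages under $\phi$. Consequently $$|\mathcal{T}_{n,k,m}|=\frac{1}{k}|\mathsf{UComp}_{n,k,m}|=\frac{1}{k}\binom{n}{k-1}\binom{n-k-1}{m-1}\binom{k}{m}.$$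
   Context: A composition of $n$ into $k$ parts is a sequence $(c_1,\ldots,c_k)$ of positive integers summing to $n$. A plane tree is a rooted tree in which the children of each vertex are linearly ordered; the degree of a vertex is its number of children; an internal node is a vertex of degree at least $1$. -}

module Defs where

open import Data.Nat using (ℕ; zero; suc; _+_; _<_; _<ᵇ_)
open import Data.Bool using (Bool; true; false; if_then_else_)
open import Data.List using (List; []; _∷_; length; filter)
open import Data.Nat.ListAction using (sum)
open import Data.List.Relation.Unary.All using (All)
open import Data.Fin.Subset using (Subset; ∣_∣)
open import Data.Product using (Σ; _×_)
open import Relation.Binary.PropositionalEquality using (_≡_)
open import Relation.Nullary.Decidable using (Dec)
open import Data.Nat using (_<?_)

data PTree : Set where
  node : List PTree → PTree

mutual
  edges : PTree → ℕ
  edges (node ts) = length ts + edgesF ts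

  edgesF : List PTree → ℕ
  edgesF [] = 0
  edgesF (t ∷ ts) = edges t + edgesF ts

mutual
  internal : PTree → ℕ
  internal (node []) = 0
  internal (node (t ∷ ts)) = 1 + internalF (t ∷ ts)

  internalF : List PTree → ℕ
  internalF [] = 0
  internalF (t ∷ ts) = internal t + internalF ts

mutual
  branching : PTree → ℕ
  branching (node ts) = (if 1 <ᵇ length ts then 1 else 0) + branchingF ts

  branchingF : List PTree → ℕ
  branchingF [] = 0
  branchingF (t ∷ ts) = branching t + branchingF ts

Trees : ℕ → ℕ → ℕ → Set
Trees n k m = Σ PTree (λ t → edges t ≡ n × internal t ≡ k × branching t ≡ m)

Comp : ℕ → ℕ → ℕ → Set
Comp n k m = Σ (List ℕ) (λ c →
  All (0 <_) c × sum c ≡ n × length c ≡ k × length (filter (1 <?_) c) ≡ m)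

UComp : ℕ → ℕ → ℕ → Set
UComp n k m = Σ (Subset n) (λ A → suc ∣ A ∣ ≡ k) × Comp n k m

{-# OPTIONS --safe #-}
module Submission where

-- Write (A , c) as the word c₁ a₁ … aₙ, where aᵢ is the next part of c if i ∈ A and 0 otherwise.
-- This word has length n + 1 and letter sum n, so by the cycle lemma exactly one of its rotations is a
-- Łukasiewicz word, i.e. the preorder degree sequence of a plane tree with n edges, whose internal
-- nodes and nodes of degree > 1 are the k nonzero letters and the m letters > 1.  Remembering which
-- nonzero letter was c₁ turns this into a bijection UComp n k m ≅ Trees n k m × Fin k.  The count
-- follows from Pascal's rule, since a composition is determined by the set of its parts exceeding 1
-- together with the composition formed by their excesses.

open import Data.Nat.Properties
  using (suc-injective; +-suc; +-assoc; +-comm; +-identityʳ; +-cancelʳ-≡; *-comm; *-assoc; ≤-irrelevant;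
         m≢1+n+m; m+n∸m≡n; m+[n∸m]≡n; m+n∸n≡m; m+n≤o⇒m≤o; m+n≤o⇒m≤o∸n; m≤n⇒m⊓n≡m; m≤n+m;
         +-commutativeSemigroup)
open import Algebra.Properties.CommutativeSemigroup +-commutativeSemigroup using (x∙yz≈y∙xz; xy∙z≈xz∙y)
open import Axiom.UniquenessOfIdentityProofs.WithK using (uip)
open import Data.Bool using (true; false; if_then_else_)
open import Data.Empty using (⊥-elim)
open import Data.Fin as Fin using (Fin)
open import Data.Fin.Properties using (_≟_; 1↔⊤; +↔⊎; *↔×; cantor-schröder-bernstein)
open import Data.Fin.Subset using (Subset; ∣_∣)
open import Data.List using (List; []; _∷_; _++_; length; filter; map; foldr; take; drop)
open import Data.List.Properties
  using (length-map; length-++; length-take; length-drop; take++drop≡id; filter-reject; map-∘; map-id;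
         ++-identityʳ; ++-assoc; ++-conicalʳ; ∷-injective)
open import Data.List.Relation.Binary.Permutation.Propositional using (_↭_)
open import Data.List.Relation.Binary.Permutation.Propositional.Properties using (↭-length; filter-↭; ++-comm)
open import Data.List.Relation.Unary.All as All using (All; []; _∷_)
open import Data.List.Relation.Unary.All.Properties using (all-filter; map⁺)
open import Data.Nat using (ℕ; zero; suc; pred; _+_; _*_; _∸_; _≤_; _<_; _<?_; _<ᵇ_; z≤n; s≤s)
open import Data.Nat.Combinatorics using (_C_; nCk+nC[k+1]≡[n+1]C[k+1])
open import Data.Nat.ListAction using (sum)
open import Data.Nat.ListAction.Properties using (sum-++; sum-↭)
open import Data.Product using (Σ; ∃-syntax; _×_; _,_; proj₁; proj₂)
open import Data.Product.Algebra using (×-cong; ×-comm)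
open import Data.Product.Function.Dependent.Propositional using (Σ-↔)
open import Data.Sum using (_⊎_; inj₁; inj₂; [_,_])
open import Data.Sum.Algebra using (⊎-cong)
open import Data.Unit using (⊤)
open import Data.Vec using ([]; _∷_)
open import Function using (_∘_; id)
open import Function.Bundles using (_↔_; mk↔ₛ′; Inverse; Injection)
open import Function.Properties.Inverse using (↔-refl; ↔-sym; ↔-trans; ↔⇒↣)
open import Function.Related.Propositional using (module EquationalReasoning)
open import Relation.Binary.PropositionalEquality
  using (_≡_; refl; sym; trans; cong; cong₂; subst; module ≡-Reasoning)
open import Relation.Nullary using (Dec; yes; no; ¬_; does)
open import Relation.Nullary.Irrelevant using (Irrelevant)
open import Relation.Unary using (Decidable)
open import Defs

open Inverse using (to; from; strictlyInverseˡ; strictlyInverseʳ)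

Σ-≡-irrelevant : {A : Set} {P : A → Set} → (∀ {a} → Irrelevant (P a)) →
                 {x y : Σ A P} → proj₁ x ≡ proj₁ y → x ≡ y
Σ-≡-irrelevant irr {a , p} {.a , q} refl = cong (a ,_) (irr p q)

×-irrelevant : {A B : Set} → Irrelevant A → Irrelevant B → Irrelevant (A × B)
×-irrelevant irrA irrB (a , b) (a′ , b′) = cong₂ _,_ (irrA a a′) (irrB b b′)

⊎-dropˡ : {A B : Set} → ¬ A → (A ⊎ B) ↔ B
⊎-dropˡ ¬a = mk↔ₛ′ [ ⊥-elim ∘ ¬a , id ] inj₂ (λ _ → refl) [ ⊥-elim ∘ ¬a , (λ _ → refl) ]

⊎-dropʳ : {A B : Set} → ¬ B → (A ⊎ B) ↔ A
⊎-dropʳ ¬b = mk↔ₛ′ [ id , ⊥-elim ∘ ¬b ] inj₁ (λ _ → refl) [ (λ _ → refl) , ⊥-elim ∘ ¬b ]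

Σ-Fin-finite : ∀ M {P : Fin M → Set} → (∀ i → Dec (P i)) → (∀ {i} → Irrelevant (P i)) →
               ∃[ N ] (Σ (Fin M) P ↔ Fin N)
Σ-Fin-finite zero P? irr = 0 , mk↔ₛ′ (λ ()) (λ ()) (λ ()) (λ ())
Σ-Fin-finite (suc M) {P} P? irr with Σ-Fin-finite M (P? ∘ Fin.suc) irr | P? Fin.zero
... | N , e | yes p = suc N , mk↔ₛ′ to′ from′ to∘from from∘to
  where
  to′ : Σ (Fin (suc M)) P → Fin (suc N)
  to′ (Fin.zero , _) = Fin.zero
  to′ (Fin.suc i , q) = Fin.suc (to e (i , q))
  from′ : Fin (suc N) → Σ (Fin (suc M)) P
  from′ Fin.zero = Fin.zero , p
  from′ (Fin.suc j) = let i , q = from e j in Fin.suc i , q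
  to∘from : ∀ j → to′ (from′ j) ≡ j
  to∘from Fin.zero = refl
  to∘from (Fin.suc j) = cong Fin.suc (strictlyInverseˡ e j)
  from∘to : ∀ x → from′ (to′ x) ≡ x
  from∘to (Fin.zero , q) = cong (Fin.zero ,_) (irr p q)
  from∘to (Fin.suc i , q) = cong (λ (i , q) → Fin.suc i , q) (strictlyInverseʳ e (i , q))
... | N , e | no ¬p = N , mk↔ₛ′ to′ from′ to∘from from∘to
  where
  to′ : Σ (Fin (suc M)) P → Fin N
  to′ (Fin.zero , q) = ⊥-elim (¬p q)
  to′ (Fin.suc i , q) = to e (i , q)
  from′ : Fin N → Σ (Fin (suc M)) P
  from′ j = let i , q = from e j in Fin.suc i , q
  to∘from : ∀ j → to′ (from′ j) ≡ j
  to∘from = strictlyInverseˡ e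
  from∘to : ∀ x → from′ (to′ x) ≡ x
  from∘to (Fin.zero , q) = ⊥-elim (¬p q)
  from∘to (Fin.suc i , q) = cong (λ (i , q) → Fin.suc i , q) (strictlyInverseʳ e (i , q))

Fin-↔⇒≡ : ∀ {m n} → Fin m ↔ Fin n → m ≡ n
Fin-↔⇒≡ e = cantor-schröder-bernstein (Injection.injective (↔⇒↣ e)) (Injection.injective (↔⇒↣ (↔-sym e)))

fibres-↔ : ∀ {U T B F : Set} (f : T → B) → (∀ {t t′} → f t ≡ f t′ → t ≡ t′) →
           (e : U ↔ (T × F)) → ∀ t → F ↔ Σ U (λ u → f (proj₁ (to e u)) ≡ f t)
fibres-↔ {U} {T} {B} {F} f f-injective e t = mk↔ₛ′ to′ from′ to∘from from∘to
  where
  to′ : F → Σ U (λ u → f (proj₁ (to e u)) ≡ f t)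
  to′ x = from e (t , x) , cong (f ∘ proj₁) (strictlyInverseˡ e (t , x))
  from′ : Σ U (λ u → f (proj₁ (to e u)) ≡ f t) → F
  from′ (u , _) = proj₂ (to e u)
  to∘from : ∀ y → to′ (from′ y) ≡ y
  to∘from (u , q) = Σ-≡-irrelevant uip
    (trans (cong (λ t′ → from e (t′ , proj₂ (to e u))) (sym (f-injective q))) (strictlyInverseʳ e u))
  from∘to : ∀ x → from′ (to′ x) ≡ x
  from∘to x = cong proj₂ (strictlyInverseˡ e (t , x))

-- T is the fibre over 0 of the second projection, a decidable subset of Fin M.
Fin-quotient : ∀ {U T : Set} {M j} → U ↔ Fin M → U ↔ (T × Fin (suc j)) →
               ∃[ N ] (T ↔ Fin N) × suc j * N ≡ M
Fin-quotient {U} {T} {M} {j} U↔M e = N , T↔N , trans (*-comm (suc j) N) (Fin-↔⇒≡ (begin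
  Fin (N * suc j)        ↔⟨ *↔× ⟩
  (Fin N × Fin (suc j))  ↔⟨ ×-cong (↔-sym T↔N) ↔-refl ⟩
  (T × Fin (suc j))      ↔⟨ ↔-sym e ⟩
  U                      ↔⟨ U↔M ⟩
  Fin M                  ∎))
  where
  open EquationalReasoning
  e′ : Fin M ↔ (Fin (suc j) × T)
  e′ = ↔-trans (↔-sym U↔M) (↔-trans e (×-comm T (Fin (suc j))))
  fibre-finite : ∃[ N ] (Σ (Fin M) (λ i → proj₁ (to e′ i) ≡ Fin.zero) ↔ Fin N)
  fibre-finite = Σ-Fin-finite M (λ i → proj₁ (to e′ i) ≟ Fin.zero) uip
  N = proj₁ fibre-finite
  T↔N : T ↔ Fin N
  T↔N = ↔-trans (fibres-↔ id id e′ Fin.zero) (proj₂ fibre-finite)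

-- Counting by Pascal's rule

binomial-count : (X : ℕ → ℕ → Set) →
  X 0 0 ↔ ⊤ → (∀ j → ¬ X 0 (suc j)) → (∀ n → X (suc n) 0 ↔ X n 0) →
  (∀ n j → X (suc n) (suc j) ↔ (X n (suc j) ⊎ X n j)) →
  ∀ n j → X n j ↔ Fin (n C j)
binomial-count X X00 X0s Xs0 Xss = count
  where
  open EquationalReasoning
  count : ∀ n j → X n j ↔ Fin (n C j)
  count zero zero = begin X 0 0 ↔⟨ X00 ⟩ ⊤ ↔⟨ ↔-sym 1↔⊤ ⟩ Fin 1 ∎
  count zero (suc j) = mk↔ₛ′ (⊥-elim ∘ X0s j) (λ ()) (λ ()) (⊥-elim ∘ X0s j)
  count (suc n) zero = begin X (suc n) 0 ↔⟨ Xs0 n ⟩ X n 0 ↔⟨ count n zero ⟩ Fin 1 ∎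
  count (suc n) (suc j) = begin
    X (suc n) (suc j)                 ↔⟨ Xss n j ⟩
    (X n (suc j) ⊎ X n j)             ↔⟨ ⊎-cong (count n (suc j)) (count n j) ⟩
    (Fin (n C suc j) ⊎ Fin (n C j))   ↔⟨ ↔-sym +↔⊎ ⟩
    Fin (n C suc j + n C j)           ≡⟨ cong Fin (+-comm (n C suc j) (n C j)) ⟩
    Fin (n C j + n C suc j)           ≡⟨ cong Fin (nCk+nC[k+1]≡[n+1]C[k+1] n j) ⟩
    Fin (suc n C suc j)               ∎

Subsets : ℕ → ℕ → Set
Subsets n j = Σ (Subset n) (λ A → ∣ A ∣ ≡ j)

Subsets-count : ∀ n j → Subsets n j ↔ Fin (n C j)
Subsets-count = binomial-count Subsets only-empty none first-outside first-inside-or-outside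
  where
  only-empty : Subsets 0 0 ↔ ⊤
  only-empty = mk↔ₛ′ _ (λ _ → [] , refl) (λ _ → refl) λ { ([] , refl) → refl }
  none : ∀ j → ¬ Subsets 0 (suc j)
  none j ([] , ())
  first-outside : ∀ n → Subsets (suc n) 0 ↔ Subsets n 0
  first-outside n = mk↔ₛ′ to′ from′ (λ _ → refl) from∘to
    where
    to′ : Subsets (suc n) 0 → Subsets n 0
    to′ (false ∷ A , p) = A , p
    from′ : Subsets n 0 → Subsets (suc n) 0
    from′ (A , p) = false ∷ A , p
    from∘to : ∀ x → from′ (to′ x) ≡ x
    from∘to (false ∷ A , p) = refl
  first-inside-or-outside : ∀ n j → Subsets (suc n) (suc j) ↔ (Subsets n (suc j) ⊎ Subsets n j)
  first-inside-or-outside n j = mk↔ₛ′ to′ from′ to∘from from∘to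
    where
    to′ : Subsets (suc n) (suc j) → Subsets n (suc j) ⊎ Subsets n j
    to′ (false ∷ A , p) = inj₁ (A , p)
    to′ (true ∷ A , p) = inj₂ (A , suc-injective p)
    from′ : Subsets n (suc j) ⊎ Subsets n j → Subsets (suc n) (suc j)
    from′ (inj₁ (A , p)) = false ∷ A , p
    from′ (inj₂ (A , p)) = true ∷ A , cong suc p
    to∘from : ∀ x → to′ (from′ x) ≡ x
    to∘from (inj₁ _) = refl
    to∘from (inj₂ (A , refl)) = refl
    from∘to : ∀ x → from′ (to′ x) ≡ x
    from∘to (false ∷ A , _) = refl
    from∘to (true ∷ A , refl) = refl

Composition : ℕ → ℕ → Set
Composition n k = Σ (List ℕ) (λ c → All (0 <_) c × sum c ≡ n × length c ≡ k)

Composition-≡ : ∀ {n k} {c c′ : Composition n k} → proj₁ c ≡ proj₁ c′ → c ≡ c′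
Composition-≡ = Σ-≡-irrelevant (×-irrelevant (All.irrelevant ≤-irrelevant) (×-irrelevant uip uip))

empty-composition : Composition 0 0 ↔ ⊤
empty-composition = mk↔ₛ′ _ (λ _ → [] , [] , refl , refl) (λ _ → refl) λ { ([] , [] , refl , refl) → refl }

no-composition-of-0 : ∀ j → ¬ Composition 0 (suc j)
no-composition-of-0 j (zero ∷ c , () ∷ _ , _)
no-composition-of-0 j (suc x ∷ c , _ , () , _)

no-composition-into-0 : ∀ n → ¬ Composition (suc n) 0
no-composition-into-0 n ([] , _ , () , _)

Composition-first-part-↔ : ∀ n j → Composition (suc n) (suc j) ↔ (Composition n (suc j) ⊎ Composition n j)
Composition-first-part-↔ n j = mk↔ₛ′ to′ from′ to∘from from∘to
  where
  to′ : Composition (suc n) (suc j) → Composition n (suc j) ⊎ Composition n j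
  to′ (suc (suc x) ∷ c , _ ∷ pos , s , l) = inj₁ (suc x ∷ c , s≤s z≤n ∷ pos , suc-injective s , l)
  to′ (suc zero ∷ c , _ ∷ pos , s , l) = inj₂ (c , pos , suc-injective s , suc-injective l)
  from′ : Composition n (suc j) ⊎ Composition n j → Composition (suc n) (suc j)
  from′ (inj₁ (suc x ∷ c , _ ∷ pos , s , l)) = suc (suc x) ∷ c , s≤s z≤n ∷ pos , cong suc s , l
  from′ (inj₂ (c , pos , s , l)) = 1 ∷ c , s≤s z≤n ∷ pos , cong suc s , cong suc l
  to∘from : ∀ c → to′ (from′ c) ≡ c
  to∘from (inj₁ (suc x ∷ c , s≤s z≤n ∷ pos , refl , refl)) = refl
  to∘from (inj₂ (c , pos , refl , refl)) = refl
  from∘to : ∀ c → from′ (to′ c) ≡ c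
  from∘to (suc (suc x) ∷ c , s≤s z≤n ∷ pos , refl , refl) = refl
  from∘to (suc zero ∷ c , s≤s z≤n ∷ pos , refl , refl) = refl

Compositions-count : ∀ n j → Composition (suc n) (suc j) ↔ Fin (n C j)
Compositions-count = binomial-count (λ n j → Composition (suc n) (suc j))
  single-part-of-1 none-of-1 single-part-shrinks (λ n j → Composition-first-part-↔ (suc n) (suc j))
  where
  single-part-of-1 : Composition 1 1 ↔ ⊤
  single-part-of-1 = begin
    Composition 1 1                      ↔⟨ Composition-first-part-↔ 0 0 ⟩
    (Composition 0 1 ⊎ Composition 0 0)  ↔⟨ ⊎-dropˡ (no-composition-of-0 0) ⟩
    Composition 0 0                      ↔⟨ empty-composition ⟩
    ⊤                                    ∎
    where open EquationalReasoning
  none-of-1 : ∀ j → ¬ Composition 1 (suc (suc j))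
  none-of-1 j =
    [ no-composition-of-0 (suc j) , no-composition-of-0 j ] ∘ to (Composition-first-part-↔ 0 (suc j))
  single-part-shrinks : ∀ n → Composition (suc (suc n)) 1 ↔ Composition (suc n) 1
  single-part-shrinks n = ↔-trans (Composition-first-part-↔ (suc n) 0) (⊎-dropʳ (no-composition-into-0 n))

-- Words and their supports

count : {A : Set} {P : A → Set} → Decidable P → List A → ℕ
count P? = length ∘ filter P?

count-∷ : ∀ {A : Set} {P : A → Set} (P? : Decidable P) x w →
          count P? (x ∷ w) ≡ (if does (P? x) then 1 else 0) + count P? w
count-∷ P? x w with does (P? x)
... | true = refl
... | false = refl

nonzeros : List ℕ → List ℕ
nonzeros = filter (0 <?_)

support : (n : ℕ) → List ℕ → Subset n
support zero _ = []
support (suc n) [] = false ∷ support n []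
support (suc n) (zero ∷ s) = false ∷ support n s
support (suc n) (suc _ ∷ s) = true ∷ support n s

merge : ∀ {n} → Subset n → List ℕ → List ℕ
merge [] _ = []
merge (false ∷ A) c = 0 ∷ merge A c
merge (true ∷ A) [] = 0 ∷ merge A []
merge (true ∷ A) (x ∷ c) = x ∷ merge A c

length-merge : ∀ {n} (A : Subset n) c → length (merge A c) ≡ n
length-merge [] c = refl
length-merge (false ∷ A) c = cong suc (length-merge A c)
length-merge (true ∷ A) [] = cong suc (length-merge A [])
length-merge (true ∷ A) (x ∷ c) = cong suc (length-merge A c)

merge-support : ∀ n s → length s ≡ n → merge (support n s) (nonzeros s) ≡ s
merge-support zero [] _ = refl
merge-support (suc n) (zero ∷ s) l = cong (0 ∷_) (merge-support n s (suc-injective l))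
merge-support (suc n) (suc x ∷ s) l = cong (suc x ∷_) (merge-support n s (suc-injective l))

∣support∣ : ∀ n s → length s ≡ n → ∣ support n s ∣ ≡ count (0 <?_) s
∣support∣ zero [] _ = refl
∣support∣ (suc n) (zero ∷ s) l = ∣support∣ n s (suc-injective l)
∣support∣ (suc n) (suc x ∷ s) l = cong suc (∣support∣ n s (suc-injective l))

support-merge : ∀ {n} (A : Subset n) c → All (0 <_) c → length c ≡ ∣ A ∣ → support n (merge A c) ≡ A
support-merge [] c _ _ = refl
support-merge (false ∷ A) c pos l = cong (false ∷_) (support-merge A c pos l)
support-merge (true ∷ A) (suc x ∷ c) (_ ∷ pos) l = cong (true ∷_) (support-merge A c pos (suc-injective l))

nonzeros-merge : ∀ {n} (A : Subset n) c → All (0 <_) c → length c ≡ ∣ A ∣ → nonzeros (merge A c) ≡ c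
nonzeros-merge [] [] _ _ = refl
nonzeros-merge (false ∷ A) c pos l = nonzeros-merge A c pos l
nonzeros-merge (true ∷ A) (suc x ∷ c) (_ ∷ pos) l = cong (suc x ∷_) (nonzeros-merge A c pos (suc-injective l))

sum-nonzeros : ∀ s → sum (nonzeros s) ≡ sum s
sum-nonzeros [] = refl
sum-nonzeros (zero ∷ s) = sum-nonzeros s
sum-nonzeros (suc x ∷ s) = cong (suc x +_) (sum-nonzeros s)

filter-nonzeros : {P : ℕ → Set} (P? : Decidable P) → ¬ P 0 → ∀ s → filter P? (nonzeros s) ≡ filter P? s
filter-nonzeros P? ¬P0 [] = refl
filter-nonzeros P? ¬P0 (zero ∷ s) = trans (filter-nonzeros P? ¬P0 s) (sym (filter-reject P? ¬P0))
filter-nonzeros P? ¬P0 (suc x ∷ s) with does (P? (suc x))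
... | true = cong (suc x ∷_) (filter-nonzeros P? ¬P0 s)
... | false = filter-nonzeros P? ¬P0 s

sum-merge : ∀ {n} (A : Subset n) c → All (0 <_) c → length c ≡ ∣ A ∣ → sum (merge A c) ≡ sum c
sum-merge A c pos l = trans (sym (sum-nonzeros (merge A c))) (cong sum (nonzeros-merge A c pos l))

filter-merge : ∀ {n} {P : ℕ → Set} (P? : Decidable P) → ¬ P 0 → (A : Subset n) → ∀ c → All (0 <_) c →
               length c ≡ ∣ A ∣ → filter P? (merge A c) ≡ filter P? c
filter-merge P? ¬P0 A c pos l =
  trans (sym (filter-nonzeros P? ¬P0 (merge A c))) (cong (filter P?) (nonzeros-merge A c pos l))

sum-map-suc : ∀ e → sum (map suc e) ≡ length e + sum e
sum-map-suc [] = refl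
sum-map-suc (x ∷ e) = cong suc (trans (cong (x +_) (sum-map-suc e)) (x∙yz≈y∙xz x (length e) (sum e)))

count-map-suc : ∀ e → count (1 <?_) (map suc e) ≡ count (0 <?_) e
count-map-suc [] = refl
count-map-suc (zero ∷ e) = count-map-suc e
count-map-suc (suc x ∷ e) = cong suc (count-map-suc e)

map-suc-pred : ∀ c → All (0 <_) c → map suc (map pred c) ≡ c
map-suc-pred [] [] = refl
map-suc-pred (suc x ∷ c) (_ ∷ pos) = cong (suc x ∷_) (map-suc-pred c pos)

map-pred-suc : ∀ e → map pred (map suc e) ≡ e
map-pred-suc e = trans (sym (map-∘ e)) (map-id e)

Comp-≡ : ∀ {n k m} {c c′ : Comp n k m} → proj₁ c ≡ proj₁ c′ → c ≡ c′
Comp-≡ = Σ-≡-irrelevant (×-irrelevant (All.irrelevant ≤-irrelevant) (×-irrelevant uip (×-irrelevant uip uip)))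

WeakComposition : ℕ → ℕ → ℕ → Set
WeakComposition N k m = Σ (List ℕ) (λ e → sum e ≡ N × length e ≡ k × count (0 <?_) e ≡ m)

WeakComposition-≡ : ∀ {N k m} {e e′ : WeakComposition N k m} → proj₁ e ≡ proj₁ e′ → e ≡ e′
WeakComposition-≡ = Σ-≡-irrelevant (×-irrelevant uip (×-irrelevant uip uip))

Comp-↔-WeakComposition : ∀ {n k m} → k ≤ n → Comp n k m ↔ WeakComposition (n ∸ k) k m
Comp-↔-WeakComposition {n} {k} {m} k≤n = mk↔ₛ′ to′ from′
  (λ (e , _) → WeakComposition-≡ (map-pred-suc e)) (λ (c , pos , _) → Comp-≡ (map-suc-pred c pos))
  where
  to′ : Comp n k m → WeakComposition (n ∸ k) k m
  to′ (c , pos , s , l , b) = e , sum-e , trans (length-map pred c) l , trans (sym big-e) b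
    where
    e = map pred c
    c≡ : map suc e ≡ c
    c≡ = map-suc-pred c pos
    big-e : count (1 <?_) c ≡ count (0 <?_) e
    big-e = trans (cong (count (1 <?_)) (sym c≡)) (count-map-suc e)
    sum-e : sum e ≡ n ∸ k
    sum-e = begin
      sum e                ≡⟨ m+n∸m≡n k (sum e) ⟨
      k + sum e ∸ k        ≡⟨ cong (λ h → h + sum e ∸ k) (trans (length-map pred c) l) ⟨
      length e + sum e ∸ k ≡⟨ cong (_∸ k) (sum-map-suc e) ⟨
      sum (map suc e) ∸ k  ≡⟨ cong (λ c → sum c ∸ k) c≡ ⟩
      sum c ∸ k            ≡⟨ cong (_∸ k) s ⟩
      n ∸ k                ∎
      where open ≡-Reasoning
  from′ : WeakComposition (n ∸ k) k m → Comp n k m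
  from′ (e , s , l , z) =
    map suc e , map⁺ (All.universal (λ _ → s≤s z≤n) e) , sum-c , trans (length-map suc e) l ,
    trans (count-map-suc e) z
    where
    open ≡-Reasoning
    sum-c : sum (map suc e) ≡ n
    sum-c = begin
      sum (map suc e)   ≡⟨ sum-map-suc e ⟩
      length e + sum e  ≡⟨ cong₂ _+_ l s ⟩
      k + (n ∸ k)       ≡⟨ m+[n∸m]≡n k≤n ⟩
      n                 ∎

WeakComposition-↔-support : ∀ {N k m} → WeakComposition N k m ↔ (Composition N m × Subsets k m)
WeakComposition-↔-support {N} {k} {m} = mk↔ₛ′ to′ from′ to∘from from∘to
  where
  to′ : WeakComposition N k m → Composition N m × Subsets k m
  to′ (e , s , l , z) =
    (nonzeros e , all-filter (0 <?_) e , trans (sum-nonzeros e) s , z) ,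
    (support k e , trans (∣support∣ k e l) z)
  from′ : Composition N m × Subsets k m → WeakComposition N k m
  from′ ((c , pos , s , l) , (A , pA)) =
    merge A c , trans (sum-merge A c pos (trans l (sym pA))) s , length-merge A c ,
    trans (cong length (nonzeros-merge A c pos (trans l (sym pA)))) l
  to∘from : ∀ x → to′ (from′ x) ≡ x
  to∘from ((c , pos , s , l) , (A , pA)) =
    cong₂ _,_ (Composition-≡ (nonzeros-merge A c pos (trans l (sym pA))))
              (Σ-≡-irrelevant uip (support-merge A c pos (trans l (sym pA))))
  from∘to : ∀ e → from′ (to′ e) ≡ e
  from∘to (e , s , l , z) = WeakComposition-≡ (merge-support k e l)

Comp-count : ∀ {n k m} → 1 ≤ m → k + m ≤ n → Comp n k m ↔ Fin (((n ∸ k ∸ 1) C (m ∸ 1)) * (k C m))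
Comp-count {n} {k} {suc m} (s≤s z≤n) k+m≤n = begin
  Comp n k (suc m)                                   ↔⟨ Comp-↔-WeakComposition (m+n≤o⇒m≤o k k+m≤n) ⟩
  WeakComposition (n ∸ k) k (suc m)                  ↔⟨ WeakComposition-↔-support ⟩
  (Composition (n ∸ k) (suc m) × Subsets k (suc m))  ↔⟨ ×-cong excess-count (Subsets-count k (suc m)) ⟩
  (Fin ((n ∸ k ∸ 1) C m) × Fin (k C suc m))          ↔⟨ *↔× ⟨
  Fin (((n ∸ k ∸ 1) C m) * (k C suc m))              ∎
  where
  open EquationalReasoning
  excess-count : Composition (n ∸ k) (suc m) ↔ Fin ((n ∸ k ∸ 1) C m)
  excess-count with n ∸ k | m+n≤o⇒m≤o∸n (suc m) (subst (_≤ n) (+-comm k (suc m)) k+m≤n)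
  ... | suc N | _ = Compositions-count N m

Profile : ℕ → ℕ → ℕ → List ℕ → Set
Profile n k m w = sum w ≡ n × count (0 <?_) w ≡ k × count (1 <?_) w ≡ m

Profile-irrelevant : ∀ {n k m} w → Irrelevant (Profile n k m w)
Profile-irrelevant _ = ×-irrelevant uip (×-irrelevant uip uip)

Profile-↭ : ∀ {n k m u v} → u ↭ v → Profile n k m u → Profile n k m v
Profile-↭ π (s , a , b) =
  trans (sym (sum-↭ π)) s ,
  trans (sym (↭-length (filter-↭ (0 <?_) π))) a ,
  trans (sym (↭-length (filter-↭ (1 <?_) π))) b

Profile-subst : ∀ {n k m n′ k′ m′} w → Profile n k m w → n ≡ n′ × k ≡ k′ × m ≡ m′ → Profile n′ k′ m′ w
Profile-subst w pr (refl , refl , refl) = pr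

Profile-functional : ∀ {n k m n′ k′ m′} w → Profile n k m w → Profile n′ k′ m′ w → n ≡ n′ × k ≡ k′ × m ≡ m′
Profile-functional w (refl , refl , refl) (refl , refl , refl) = refl , refl , refl

Profile-merge : ∀ {n N k m} (A : Subset n) c → All (0 <_) c → length c ≡ ∣ A ∣ →
                sum c ≡ N × length c ≡ k × count (1 <?_) c ≡ m → Profile N k m (merge A c)
Profile-merge A c pos l (s , #k , #m) =
  trans (sum-merge A c pos l) s ,
  trans (cong length (nonzeros-merge A c pos l)) #k ,
  trans (cong length (filter-merge (1 <?_) (λ ()) A c pos l)) #m

Profile-nonzeros : ∀ {n k m} s → Profile n k m s →
                   sum (nonzeros s) ≡ n × length (nonzeros s) ≡ k × count (1 <?_) (nonzeros s) ≡ m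
Profile-nonzeros s (s≡ , #k , #m) =
  trans (sum-nonzeros s) s≡ , #k , trans (cong length (filter-nonzeros (1 <?_) (λ ()) s)) #m

HeadedWord : ℕ → ℕ → ℕ → Set
HeadedWord n k m = Σ (ℕ × List ℕ) λ (x , s) → 0 < x × length s ≡ n × Profile n k m (x ∷ s)

HeadedWord-≡ : ∀ {n k m} {w w′ : HeadedWord n k m} → proj₁ w ≡ proj₁ w′ → w ≡ w′
HeadedWord-≡ = Σ-≡-irrelevant λ { {x , s} →
  ×-irrelevant ≤-irrelevant (×-irrelevant uip (Profile-irrelevant (x ∷ s))) }

UComp-↔-HeadedWord : ∀ {n j m} → UComp n (suc j) m ↔ HeadedWord n (suc j) m
UComp-↔-HeadedWord {n} {j} {m} = mk↔ₛ′ to′ from′ to∘from from∘to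
  where
  to′ : UComp n (suc j) m → HeadedWord n (suc j) m
  to′ ((A , pA) , (x ∷ c , x>0 ∷ pos , s , l , b)) =
    (x , merge A c) , x>0 , length-merge A c ,
    Profile-merge (true ∷ A) (x ∷ c) (x>0 ∷ pos) (trans l (sym pA)) (s , l , b)
  from′ : HeadedWord n (suc j) m → UComp n (suc j) m
  from′ ((suc x , s) , x>0 , ls , pr) =
    (support n s , cong suc (trans (∣support∣ n s ls) (suc-injective (proj₁ (proj₂ pr))))) ,
    (suc x ∷ nonzeros s , x>0 ∷ all-filter (0 <?_) s , Profile-nonzeros (suc x ∷ s) pr)
  to∘from : ∀ w → to′ (from′ w) ≡ w
  to∘from ((suc x , s) , s≤s z≤n , ls , pr) = HeadedWord-≡ (cong (suc x ,_) (merge-support n s ls))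
  from∘to : ∀ u → from′ (to′ u) ≡ u
  from∘to ((A , pA) , (suc x ∷ c , s≤s z≤n ∷ pos , s , l , b)) =
    cong₂ _,_ (Σ-≡-irrelevant uip (support-merge A c pos lc))
              (Comp-≡ (cong (suc x ∷_) (nonzeros-merge A c pos lc)))
    where lc = suc-injective (trans l (sym pA))

UComp-count : ∀ {n j m} → 1 ≤ m → suc j + m ≤ n →
              UComp n (suc j) m ↔ Fin ((n C j) * ((n ∸ suc j ∸ 1) C (m ∸ 1)) * (suc j C m))
UComp-count {n} {j} {m} 1≤m k+m≤n = begin
  UComp n (suc j) m                                                ↔⟨ ×-cong subsets (Comp-count 1≤m k+m≤n) ⟩
  (Fin (n C j) × Fin (((n ∸ suc j ∸ 1) C (m ∸ 1)) * (suc j C m)))  ↔⟨ *↔× ⟨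
  Fin ((n C j) * (((n ∸ suc j ∸ 1) C (m ∸ 1)) * (suc j C m)))      ≡⟨ cong Fin (*-assoc (n C j) _ _) ⟨
  Fin ((n C j) * ((n ∸ suc j ∸ 1) C (m ∸ 1)) * (suc j C m))        ∎
  where
  open EquationalReasoning
  subsets : Σ (Subset n) (λ A → suc ∣ A ∣ ≡ suc j) ↔ Fin (n C j)
  subsets = ↔-trans (mk↔ₛ′ (λ (A , p) → A , suc-injective p) (λ (A , p) → A , cong suc p)
                           (λ { (A , refl) → refl }) (λ { (A , refl) → refl }))
                    (Subsets-count n j)

-- Łukasiewicz paths and the cycle lemma

-- Reading the letter d at height suc i leads to height i + d, a step of d - 1; no letter is read at
-- height 0.  Thus ŁPath j w 0 says that w is the preorder degree sequence of a forest of j plane trees.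
data ŁPath : ℕ → List ℕ → ℕ → Set where
  [] : ∀ {i} → ŁPath i [] i
  _∷_ : ∀ {i j w} d → ŁPath (i + d) w j → ŁPath (suc i) (d ∷ w) j

IsŁuk : List ℕ → Set
IsŁuk w = ŁPath 1 w 0

ŁPath-irrelevant : ∀ {i w j} → Irrelevant (ŁPath i w j)
ŁPath-irrelevant [] [] = refl
ŁPath-irrelevant (d ∷ p) (.d ∷ q) = cong (d ∷_) (ŁPath-irrelevant p q)

ŁPath-++ : ∀ {i j k u v} → ŁPath i u j → ŁPath j v k → ŁPath i (u ++ v) k
ŁPath-++ [] q = q
ŁPath-++ (d ∷ p) q = d ∷ ŁPath-++ p q

ŁPath-split : ∀ {i k} u {v} → ŁPath i (u ++ v) k → ∃[ j ] ŁPath i u j × ŁPath j v k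
ŁPath-split [] p = _ , [] , p
ŁPath-split (d ∷ u) (.d ∷ p) = let j , q , r = ŁPath-split u p in j , d ∷ q , r

ŁPath-shift : ∀ {i w j} e → ŁPath i w j → ŁPath (i + e) w (j + e)
ŁPath-shift e [] = []
ŁPath-shift {suc i} {d ∷ w} {j} e (d ∷ p) =
  d ∷ subst (λ h → ŁPath h w (j + e)) (xy∙z≈xz∙y i d e) (ŁPath-shift e p)

ŁPath-length : ∀ {i w j} → ŁPath i w j → i + sum w ≡ j + length w
ŁPath-length [] = refl
ŁPath-length {suc i} {d ∷ w} {j} (d ∷ p) = begin
  suc (i + (d + sum w))  ≡⟨ cong suc (+-assoc i d (sum w)) ⟨
  suc (i + d + sum w)    ≡⟨ cong suc (ŁPath-length p) ⟩
  suc (j + length w)     ≡⟨ +-suc j (length w) ⟨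
  j + suc (length w)     ∎
  where open ≡-Reasoning

IsŁuk-length : ∀ {w} → IsŁuk w → length w ≡ suc (sum w)
IsŁuk-length ł = sym (ŁPath-length ł)

+-compare : ∀ d j → (∃[ i ] j ≡ i + d) ⊎ (∃[ e ] d ≡ j + suc e)
+-compare zero j = inj₁ (j , sym (+-identityʳ j))
+-compare (suc d) zero = inj₂ (d , refl)
+-compare (suc d) (suc j) with +-compare d j
... | inj₁ (i , refl) = inj₁ (i , sym (+-suc i d))
... | inj₂ (e , refl) = inj₂ (e , refl)

-- v ends where the walk of s first attains its minimum height; after that, u never goes lower.
data ForestThenMeander (s : List ℕ) : Set where
  split : ∀ {j c} v u → s ≡ v ++ u → ŁPath j v 0 → ŁPath 1 u (suc c) → ForestThenMeander s

forest-then-meander : ∀ s → ForestThenMeander s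
forest-then-meander [] = split {j = 0} [] [] refl [] []
forest-then-meander (d ∷ s) with forest-then-meander s
... | split {j} v u refl p q with +-compare d j
...   | inj₁ (i , refl) = split (d ∷ v) u refl (d ∷ p) q
...   | inj₂ (e , refl) =
  split [] (d ∷ v ++ u) refl [] (d ∷ ŁPath-++ (ŁPath-shift (suc e) p) (ŁPath-shift e q))

-- As the word has one letter more than its sum, the forest v has as many trees as the height at
-- which the meander u ends.
meander-then-forest : ∀ {j c} v u → ŁPath j v 0 → ŁPath 1 u (suc c) →
                      length (v ++ u) ≡ suc (sum (v ++ u)) → IsŁuk (u ++ v)
meander-then-forest {j} {c} v u p q len = ŁPath-++ q (subst (λ h → ŁPath h v 0) j≡1+c p)
  where
  open ≡-Reasoning
  j≡1+c : j ≡ suc c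
  j≡1+c = +-cancelʳ-≡ (sum v + suc (sum u)) j (suc c) (begin
    j + (sum v + suc (sum u))     ≡⟨ +-assoc j (sum v) (suc (sum u)) ⟨
    j + sum v + suc (sum u)       ≡⟨ cong (_+ suc (sum u)) (ŁPath-length p) ⟩
    length v + suc (sum u)        ≡⟨ cong (length v +_) (ŁPath-length q) ⟩
    length v + (suc c + length u) ≡⟨ x∙yz≈y∙xz (length v) (suc c) (length u) ⟩
    suc c + (length v + length u) ≡⟨ cong (suc c +_) (length-++ v) ⟨
    suc c + length (v ++ u)       ≡⟨ cong (suc c +_) len ⟩
    suc c + suc (sum (v ++ u))    ≡⟨ cong (λ h → suc c + suc h) (sum-++ v u) ⟩
    suc c + suc (sum v + sum u)   ≡⟨ cong (suc c +_) (+-suc (sum v) (sum u)) ⟨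
    suc c + (sum v + suc (sum u)) ∎)

-- Otherwise the heights reached after t in t ++ r and after r in r ++ t would be positive with sum 1.
Łuk-rotations-trivial : ∀ t r → IsŁuk (t ++ r) → IsŁuk (r ++ t) → t ≡ [] ⊎ r ≡ []
Łuk-rotations-trivial [] r _ _ = inj₁ refl
Łuk-rotations-trivial (x ∷ t) [] _ _ = inj₂ refl
Łuk-rotations-trivial (x ∷ t) (y ∷ r) p q with ŁPath-split (x ∷ t) p | ŁPath-split (y ∷ r) q
... | suc c , _ , p₂ | suc c′ , q₁ , _ = ⊥-elim (m≢1+n+m (sum (y ∷ r)) {c′ + c} (begin
  sum (y ∷ r)                       ≡⟨ suc-injective (ŁPath-length q₁) ⟩
  c′ + length (y ∷ r)               ≡⟨ cong (c′ +_) (ŁPath-length p₂) ⟨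
  c′ + suc (c + sum (y ∷ r))        ≡⟨ +-suc c′ _ ⟩
  suc (c′ + (c + sum (y ∷ r)))      ≡⟨ cong suc (+-assoc c′ c _) ⟨
  suc (c′ + c + sum (y ∷ r))        ∎))
  where open ≡-Reasoning

++-≡-++ : ∀ {A : Set} (v₁ u₁ v₂ u₂ : List A) → v₁ ++ u₁ ≡ v₂ ++ u₂ →
          (∃[ t ] v₂ ≡ v₁ ++ t × u₁ ≡ t ++ u₂) ⊎ (∃[ t ] v₁ ≡ v₂ ++ t × u₂ ≡ t ++ u₁)
++-≡-++ [] u₁ v₂ u₂ eq = inj₁ (v₂ , refl , eq)
++-≡-++ (x ∷ v₁) u₁ [] u₂ eq = inj₂ (x ∷ v₁ , refl , sym eq)
++-≡-++ (x ∷ v₁) u₁ (y ∷ v₂) u₂ eq with ∷-injective eq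
... | refl , eq′ with ++-≡-++ v₁ u₁ v₂ u₂ eq′
...   | inj₁ (t , refl , refl) = inj₁ (t , refl , refl)
...   | inj₂ (t , refl , refl) = inj₂ (t , refl , refl)

Łuk-rotate-prefix-trivial : ∀ {x} t u v → IsŁuk ((t ++ u) ++ x ∷ v) → IsŁuk (u ++ x ∷ v ++ t) → t ≡ []
Łuk-rotate-prefix-trivial {x} t u v p q
  with Łuk-rotations-trivial t (u ++ x ∷ v) (subst IsŁuk (++-assoc t u _) p)
                                            (subst IsŁuk (sym (++-assoc u (x ∷ v) t)) q)
... | inj₁ t≡[] = t≡[]
... | inj₂ eq with () ← ++-conicalʳ u (x ∷ v) eq

RotationOf : ℕ → List ℕ → List ℕ × List ℕ → Set
RotationOf x s (v , u) = s ≡ v ++ u × IsŁuk (u ++ x ∷ v)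

RotationOf-unique : ∀ {x s} r r′ → RotationOf x s r → RotationOf x s r′ → r ≡ r′
RotationOf-unique (v , u) (v′ , u′) (refl , ł) (eq , ł′) with ++-≡-++ v u v′ u′ eq
... | inj₁ (t , refl , refl) with refl ← Łuk-rotate-prefix-trivial t u′ v ł ł′ =
  cong (_, u′) (sym (++-identityʳ v))
... | inj₂ (t , refl , refl) with refl ← Łuk-rotate-prefix-trivial t u v′ ł′ ł =
  cong (_, u) (++-identityʳ v′)

rotate : ℕ → List ℕ → List ℕ × List ℕ
rotate x s with forest-then-meander (x ∷ s)
... | split [] _ _ _ _ = s , []
... | split (_ ∷ v) u _ _ _ = v , u

rotate-RotationOf : ∀ x s → length s ≡ sum (x ∷ s) → RotationOf x s (rotate x s)
rotate-RotationOf x s len with forest-then-meander (x ∷ s)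
... | split [] u refl p q =
  sym (++-identityʳ s) ,
  subst IsŁuk (++-identityʳ (x ∷ s)) (meander-then-forest [] (x ∷ s) p q (cong suc len))
... | split (_ ∷ v) u refl p q = refl , meander-then-forest (x ∷ v) u p q (cong suc len)

rotation-length : ∀ u x v → IsŁuk (u ++ x ∷ v) → length (v ++ u) ≡ sum (x ∷ v ++ u)
rotation-length u x v ł =
  suc-injective (trans (sym (↭-length π)) (trans (IsŁuk-length ł) (cong suc (sum-↭ π))))
  where π = ++-comm u (x ∷ v)

rotate-rotation : ∀ u x v → IsŁuk (u ++ x ∷ v) → rotate x (v ++ u) ≡ (v , u)
rotate-rotation u x v ł =
  RotationOf-unique _ _ (rotate-RotationOf x (v ++ u) (rotation-length u x v ł)) (refl , ł)

PointedŁukWord : ℕ → ℕ → ℕ → Set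
PointedŁukWord n k m =
  Σ (List ℕ × ℕ × List ℕ) λ (u , x , v) → 0 < x × IsŁuk (u ++ x ∷ v) × Profile n k m (u ++ x ∷ v)

PointedŁukWord-≡ : ∀ {n k m} {w w′ : PointedŁukWord n k m} → proj₁ w ≡ proj₁ w′ → w ≡ w′
PointedŁukWord-≡ = Σ-≡-irrelevant λ { {u , x , v} →
  ×-irrelevant ≤-irrelevant (×-irrelevant ŁPath-irrelevant (Profile-irrelevant (u ++ x ∷ v))) }

HeadedWord-↔-PointedŁukWord : ∀ {n k m} → HeadedWord n k m ↔ PointedŁukWord n k m
HeadedWord-↔-PointedŁukWord {n} {k} {m} = mk↔ₛ′ to′ from′
  (λ ((u , x , v) , _ , ł , _) → PointedŁukWord-≡ (cong (λ (v , u) → u , x , v) (rotate-rotation u x v ł)))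
  (λ ((x , s) , _ , ls , pr) →
     HeadedWord-≡ (cong (x ,_) (sym (proj₁ (rotate-RotationOf x s (headed-length x s ls pr))))))
  where
  headed-length : ∀ x s → length s ≡ n → Profile n k m (x ∷ s) → length s ≡ sum (x ∷ s)
  headed-length _ _ ls pr = trans ls (sym (proj₁ pr))
  to′ : HeadedWord n k m → PointedŁukWord n k m
  to′ ((x , s) , x>0 , ls , pr) =
    (u , x , v) , x>0 , ł , Profile-↭ (++-comm (x ∷ v) u) (subst (λ s → Profile n k m (x ∷ s)) s≡ pr)
    where
    v = proj₁ (rotate x s)
    u = proj₂ (rotate x s)
    s≡ = proj₁ (rotate-RotationOf x s (headed-length x s ls pr))
    ł = proj₂ (rotate-RotationOf x s (headed-length x s ls pr))
  from′ : PointedŁukWord n k m → HeadedWord n k m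
  from′ ((u , x , v) , x>0 , ł , pr) =
    (x , v ++ u) , x>0 , trans (rotation-length u x v ł) (proj₁ pr′) , pr′
    where pr′ = Profile-↭ (++-comm u (x ∷ v)) pr

Occurrences : {A : Set} → (A → Set) → List A → Set
Occurrences {A} P w = Σ (List A × A × List A) λ (u , x , v) → u ++ x ∷ v ≡ w × P x

Occurrences-∷ : ∀ {A : Set} {P : A → Set} {y w} → Occurrences P (y ∷ w) ↔ (P y ⊎ Occurrences P w)
Occurrences-∷ {A} {P} {y} {w} = mk↔ₛ′ to′ from′ to∘from from∘to
  where
  to′ : Occurrences P (y ∷ w) → P y ⊎ Occurrences P w
  to′ (([] , _ , _) , refl , p) = inj₁ p
  to′ ((_ ∷ u , x , v) , refl , p) = inj₂ ((u , x , v) , refl , p)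
  from′ : P y ⊎ Occurrences P w → Occurrences P (y ∷ w)
  from′ (inj₁ p) = ([] , y , w) , refl , p
  from′ (inj₂ ((u , x , v) , refl , p)) = (y ∷ u , x , v) , refl , p
  to∘from : ∀ o → to′ (from′ o) ≡ o
  to∘from (inj₁ p) = refl
  to∘from (inj₂ ((u , x , v) , refl , p)) = refl
  from∘to : ∀ o → from′ (to′ o) ≡ o
  from∘to (([] , _ , _) , refl , p) = refl
  from∘to ((_ ∷ u , x , v) , refl , p) = refl

Occurrences-count : ∀ {A : Set} {P : A → Set} (P? : Decidable P) → (∀ {x} → Irrelevant (P x)) →
                    ∀ w → Occurrences P w ↔ Fin (count P? w)
Occurrences-count P? irr [] = mk↔ₛ′ (λ { (([] , _) , () , _) ; ((_ ∷ _ , _) , () , _) }) (λ ())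
  (λ ()) (λ { (([] , _) , () , _) ; ((_ ∷ _ , _) , () , _) })
Occurrences-count {P = P} P? irr (y ∷ w) with P? y
... | yes p = begin
  Occurrences P (y ∷ w)       ↔⟨ Occurrences-∷ ⟩
  (P y ⊎ Occurrences P w)     ↔⟨ ⊎-cong (irrelevant-inhabited-↔ p) (Occurrences-count P? irr w) ⟩
  (⊤ ⊎ Fin (count P? w))      ↔⟨ ⊎-cong (↔-sym 1↔⊤) ↔-refl ⟩
  (Fin 1 ⊎ Fin (count P? w))  ↔⟨ +↔⊎ ⟨
  Fin (suc (count P? w))      ∎
  where
  open EquationalReasoning
  irrelevant-inhabited-↔ : P y → P y ↔ ⊤
  irrelevant-inhabited-↔ p = mk↔ₛ′ _ (λ _ → p) (λ _ → refl) (irr p)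
... | no ¬p = ↔-trans Occurrences-∷ (↔-trans (⊎-dropˡ ¬p) (Occurrences-count P? irr w))

ŁukWord : ℕ → ℕ → ℕ → Set
ŁukWord n k m = Σ (List ℕ) λ w → IsŁuk w × Profile n k m w

PointedŁukWord-↔-ŁukWord×Fin : ∀ {n k m} → PointedŁukWord n k m ↔ (ŁukWord n k m × Fin k)
PointedŁukWord-↔-ŁukWord×Fin {n} {k} {m} = begin
  PointedŁukWord n k m                                  ↔⟨ forget-point ⟩
  Σ (ŁukWord n k m) (λ (w , _) → Occurrences (0 <_) w)  ↔⟨ Σ-↔ ↔-refl (λ { {w , _ , pr} → positions w pr }) ⟩
  (ŁukWord n k m × Fin k)                               ∎
  where
  open EquationalReasoning
  forget-point : PointedŁukWord n k m ↔ Σ (ŁukWord n k m) (λ (w , _) → Occurrences (0 <_) w)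
  forget-point = mk↔ₛ′ (λ ((u , x , v) , x>0 , ł , pr) → (u ++ x ∷ v , ł , pr) , (u , x , v) , refl , x>0)
    (λ { ((_ , ł , pr) , (u , x , v) , refl , x>0) → (u , x , v) , x>0 , ł , pr })
    (λ { ((_ , ł , pr) , (u , x , v) , refl , x>0) → refl }) (λ { ((u , x , v) , x>0 , ł , pr) → refl })
  positions : ∀ w → Profile n k m w → Occurrences (0 <_) w ↔ Fin k
  positions w (_ , #k , _) =
    subst (λ c → Occurrences (0 <_) w ↔ Fin c) #k (Occurrences-count (0 <?_) ≤-irrelevant w)

-- Plane trees as Łukasiewicz words

mutual
  preorderDegrees : PTree → List ℕ → List ℕ
  preorderDegrees (node ts) w = length ts ∷ preorderDegreesF ts w

  preorderDegreesF : List PTree → List ℕ → List ℕ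
  preorderDegreesF [] w = w
  preorderDegreesF (t ∷ ts) w = preorderDegrees t (preorderDegreesF ts w)

preorderDegreesF-++ : ∀ ts us w → preorderDegreesF (ts ++ us) w ≡ preorderDegreesF ts (preorderDegreesF us w)
preorderDegreesF-++ [] us w = refl
preorderDegreesF-++ (t ∷ ts) us w = cong (preorderDegrees t) (preorderDegreesF-++ ts us w)

-- Decoding reads the word from the right, keeping the stack of the subtrees built so far.
push : ℕ → List PTree → List PTree
push d ts = node (take d ts) ∷ drop d ts

decode : List ℕ → List PTree
decode = foldr push []

take-length-++ : ∀ {A : Set} (xs ys : List A) → take (length xs) (xs ++ ys) ≡ xs
take-length-++ [] ys = refl
take-length-++ (x ∷ xs) ys = cong (x ∷_) (take-length-++ xs ys)

drop-length-++ : ∀ {A : Set} (xs ys : List A) → drop (length xs) (xs ++ ys) ≡ ys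
drop-length-++ [] ys = refl
drop-length-++ (x ∷ xs) ys = drop-length-++ xs ys

mutual
  decode-preorderDegrees : ∀ t w → decode (preorderDegrees t w) ≡ t ∷ decode w
  decode-preorderDegrees (node ts) w = begin
    push (length ts) (decode (preorderDegreesF ts w))
      ≡⟨ cong (push (length ts)) (decode-preorderDegreesF ts w) ⟩
    push (length ts) (ts ++ decode w)
      ≡⟨ cong₂ (λ ts us → node ts ∷ us) (take-length-++ ts _) (drop-length-++ ts _) ⟩
    node ts ∷ decode w
      ∎
    where open ≡-Reasoning

  decode-preorderDegreesF : ∀ ts w → decode (preorderDegreesF ts w) ≡ ts ++ decode w
  decode-preorderDegreesF [] w = refl
  decode-preorderDegreesF (t ∷ ts) w =
    trans (decode-preorderDegrees t _) (cong (t ∷_) (decode-preorderDegreesF ts w))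

preorderDegrees-decode : ∀ {j w} → ŁPath j w 0 → length (decode w) ≡ j × preorderDegreesF (decode w) [] ≡ w
preorderDegrees-decode [] = refl , refl
preorderDegrees-decode {suc i} {d ∷ w} (d ∷ p) =
  cong suc (trans (length-drop d ts) (trans (cong (_∸ d) #ts) (m+n∸n≡m i d))) ,
  cong₂ _∷_ d≡ (begin
    preorderDegreesF (take d ts) (preorderDegreesF (drop d ts) [])
      ≡⟨ preorderDegreesF-++ (take d ts) _ [] ⟨
    preorderDegreesF (take d ts ++ drop d ts) []
      ≡⟨ cong (λ ts → preorderDegreesF ts []) (take++drop≡id d ts) ⟩
    preorderDegreesF ts []
      ≡⟨ ts≡ ⟩
    w ∎)
  where
  open ≡-Reasoning
  ts = decode w
  #ts = proj₁ (preorderDegrees-decode p)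
  ts≡ = proj₂ (preorderDegrees-decode p)
  d≡ : length (take d ts) ≡ d
  d≡ = trans (length-take d ts) (m≤n⇒m⊓n≡m (subst (d ≤_) (sym #ts) (m≤n+m d i)))

mutual
  ŁPath-preorderDegrees : ∀ t {j w k} → ŁPath j w k → ŁPath (suc j) (preorderDegrees t w) k
  ŁPath-preorderDegrees (node ts) {j} {w} {k} p =
    length ts ∷ subst (λ h → ŁPath h (preorderDegreesF ts w) k) (+-comm (length ts) j)
                      (ŁPath-preorderDegreesF ts p)

  ŁPath-preorderDegreesF : ∀ ts {j w k} → ŁPath j w k → ŁPath (length ts + j) (preorderDegreesF ts w) k
  ŁPath-preorderDegreesF [] p = p
  ŁPath-preorderDegreesF (t ∷ ts) p = ŁPath-preorderDegrees t (ŁPath-preorderDegreesF ts p)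

mutual
  sum-preorderDegrees : ∀ t w → sum (preorderDegrees t w) ≡ edges t + sum w
  sum-preorderDegrees (node ts) w =
    trans (cong (length ts +_) (sum-preorderDegreesF ts w)) (sym (+-assoc (length ts) (edgesF ts) (sum w)))

  sum-preorderDegreesF : ∀ ts w → sum (preorderDegreesF ts w) ≡ edgesF ts + sum w
  sum-preorderDegreesF [] w = refl
  sum-preorderDegreesF (t ∷ ts) w = trans (sum-preorderDegrees t _)
    (trans (cong (edges t +_) (sum-preorderDegreesF ts w)) (sym (+-assoc (edges t) (edgesF ts) (sum w))))

mutual
  internal-preorderDegrees : ∀ t w → count (0 <?_) (preorderDegrees t w) ≡ internal t + count (0 <?_) w
  internal-preorderDegrees (node []) w = refl
  internal-preorderDegrees (node (t ∷ ts)) w = cong suc (internal-preorderDegreesF (t ∷ ts) w)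

  internal-preorderDegreesF : ∀ ts w → count (0 <?_) (preorderDegreesF ts w) ≡ internalF ts + count (0 <?_) w
  internal-preorderDegreesF [] w = refl
  internal-preorderDegreesF (t ∷ ts) w = trans (internal-preorderDegrees t _)
    (trans (cong (internal t +_) (internal-preorderDegreesF ts w))
           (sym (+-assoc (internal t) (internalF ts) _)))

mutual
  branching-preorderDegrees : ∀ t w → count (1 <?_) (preorderDegrees t w) ≡ branching t + count (1 <?_) w
  branching-preorderDegrees (node ts) w = trans (count-∷ (1 <?_) (length ts) _)
    (trans (cong (b +_) (branching-preorderDegreesF ts w)) (sym (+-assoc b (branchingF ts) _)))
    where b = if 1 <ᵇ length ts then 1 else 0

  branching-preorderDegreesF : ∀ ts w →
                               count (1 <?_) (preorderDegreesF ts w) ≡ branchingF ts + count (1 <?_) w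
  branching-preorderDegreesF [] w = refl
  branching-preorderDegreesF (t ∷ ts) w = trans (branching-preorderDegrees t _)
    (trans (cong (branching t +_) (branching-preorderDegreesF ts w))
           (sym (+-assoc (branching t) (branchingF ts) _)))

Profile-preorderDegrees : ∀ t → Profile (edges t) (internal t) (branching t) (preorderDegrees t [])
Profile-preorderDegrees t =
  trans (sum-preorderDegrees t []) (+-identityʳ _) ,
  trans (internal-preorderDegrees t []) (+-identityʳ _) ,
  trans (branching-preorderDegrees t []) (+-identityʳ _)

-- The junk value for the empty forest is never reached from a Łukasiewicz word.
root : List PTree → PTree
root [] = node []
root (t ∷ _) = t

decodeTree : List ℕ → PTree
decodeTree w = root (decode w)

decodeTree-preorderDegrees : ∀ t → decodeTree (preorderDegrees t []) ≡ t
decodeTree-preorderDegrees t = cong root (decode-preorderDegrees t [])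

preorderDegrees-decodeTree : ∀ {w} → IsŁuk w → preorderDegrees (decodeTree w) [] ≡ w
preorderDegrees-decodeTree {w} ł with decode w | preorderDegrees-decode ł
... | t ∷ [] | _ , eq = eq

Trees-≡ : ∀ {n k m} {t t′ : Trees n k m} → proj₁ t ≡ proj₁ t′ → t ≡ t′
Trees-≡ = Σ-≡-irrelevant (×-irrelevant uip (×-irrelevant uip uip))

ŁukWord-≡ : ∀ {n k m} {w w′ : ŁukWord n k m} → proj₁ w ≡ proj₁ w′ → w ≡ w′
ŁukWord-≡ = Σ-≡-irrelevant λ {w} → ×-irrelevant ŁPath-irrelevant (Profile-irrelevant w)

Trees-↔-ŁukWord : ∀ {n k m} → Trees n k m ↔ ŁukWord n k m
Trees-↔-ŁukWord {n} {k} {m} = mk↔ₛ′ to′ from′ (λ (w , ł , _) → ŁukWord-≡ (preorderDegrees-decodeTree ł))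
                                      (λ (t , _) → Trees-≡ (decodeTree-preorderDegrees t))
  where
  to′ : Trees n k m → ŁukWord n k m
  to′ (t , stats) =
    preorderDegrees t [] , ŁPath-preorderDegrees t [] ,
    Profile-subst (preorderDegrees t []) (Profile-preorderDegrees t) stats
  from′ : ŁukWord n k m → Trees n k m
  from′ (w , ł , pr) = t , Profile-functional w profile-t pr
    where
    t = decodeTree w
    profile-t : Profile (edges t) (internal t) (branching t) w
    profile-t = subst (Profile _ _ _) (preorderDegrees-decodeTree ł) (Profile-preorderDegrees t)

UComp-↔-Trees×Fin : ∀ {n j m} → UComp n (suc j) m ↔ (Trees n (suc j) m × Fin (suc j))
UComp-↔-Trees×Fin {n} {j} {m} = begin
  UComp n (suc j) m                    ↔⟨ UComp-↔-HeadedWord ⟩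
  HeadedWord n (suc j) m               ↔⟨ HeadedWord-↔-PointedŁukWord ⟩
  PointedŁukWord n (suc j) m           ↔⟨ PointedŁukWord-↔-ŁukWord×Fin ⟩
  (ŁukWord n (suc j) m × Fin (suc j))  ↔⟨ ×-cong (↔-sym Trees-↔-ŁukWord) ↔-refl ⟩
  (Trees n (suc j) m × Fin (suc j))    ∎
  where open EquationalReasoning

theorem3p2 : (n k m : ℕ) → 1 ≤ m → m ≤ k → k + m ≤ n →
    Σ (UComp n k m → Trees n k m) (λ φ →
        (t : Trees n k m) → Fin k ↔ Σ (UComp n k m) (λ u → proj₁ (φ u) ≡ proj₁ t))
    × (UComp n k m ↔ Fin ((n C (k ∸ 1)) * ((n ∸ k ∸ 1) C (m ∸ 1)) * (k C m)))
    × Σ ℕ (λ N → (Trees n k m ↔ Fin N)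
        × k * N ≡ (n C (k ∸ 1)) * ((n ∸ k ∸ 1) C (m ∸ 1)) * (k C m))
theorem3p2 n zero (suc m) _ () _
theorem3p2 n (suc j) m 1≤m _ k+m≤n =
  (φ , fibres-↔ proj₁ Trees-≡ bijection) , enumeration , Fin-quotient enumeration bijection
  where
  bijection : UComp n (suc j) m ↔ (Trees n (suc j) m × Fin (suc j))
  bijection = UComp-↔-Trees×Fin
  φ : UComp n (suc j) m → Trees n (suc j) m
  φ u = proj₁ (to bijection u)
  enumeration : UComp n (suc j) m ↔ Fin ((n C j) * ((n ∸ suc j ∸ 1) C (m ∸ 1)) * (suc j C m))
  enumeration = UComp-count 1≤m k+m≤n
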